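{- Let $n>2$ and $w \in \mathfrak{S}_n$ with $\{w(1),\ldots,w(r)\}\ne\{1,\ldots,r\}$ for all $r<n$. Then every rhombic tiling of $X(w)$ has exactly two (strong) perimeter tiles if and only if $w = n\,1\,2\,3\cdots(n-1)$ or $w = 2\,3\,4\cdots n\,1$ (in one-line notation).
   Context: Elnitsky's polygon $X(w)$: starting at the top vertex, label the sides $1,\ldots,n,w(n),\ldots,w(1)$ counterclockwise; sides $1,\dots,n$ form half of a convex $2n$-gon; the other sides are drawn so that sides are parallel and congruent iff equally labeled. A rhombic tiling is a tiling of $X(w)$ by rhombi whose edges are congruent and parallel to edges of $X(w)$. A (strong) perimeter tile is a tile sharing a path of at least two of its edges with the boundary of $X(w)$. -}

module Defs where

open import Data.Nat using (ℕ; zero; suc; _∸_; _<_; _≤_)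
open import Data.Fin using (Fin; toℕ) renaming (_<_ to _<ᶠ_)
open import Data.Fin.Permutation using (Permutation′; _⟨$⟩ʳ_)
open import Data.List using (List; []; _∷_; _++_; [_]; map; allFin)
open import Data.List.Membership.Propositional using (_∈_)
open import Data.Vec using (Vec; replicate; updateAt)
open import Data.Product using (_×_; _,_; ∃; ∃₂; Σ)
open import Data.Sum using (_⊎_)
open import Relation.Binary.PropositionalEquality using (_≡_; _≢_)
open import Relation.Nullary using (¬_)

-- Labels 1..n of the paper are Fin n = {0,..,n-1}.
-- A boundary path of X(w) read from the top vertex downwards is a list of
-- side labels.  The left boundary reads 1,2,..,n; the right boundary reads
-- w(1),..,w(n) (sides are labelled w(n),..,w(1) counterclockwise).

-- Vertices are lifted to ℤ^n (here ℕ^n): a vertex reached from the top vertex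
-- along sides with labels xs is the vector counting occurrences of each label.
Vertex : ℕ → Set
Vertex n = Vec ℕ n

step : ∀ {n} → Fin n → Vertex n → Vertex n
step i v = updateAt v i suc

vertexOf : ∀ {n} → List (Fin n) → Vertex n
vertexOf {n} []       = replicate n 0
vertexOf     (x ∷ xs) = step x (vertexOf xs)

-- An edge: its upper endpoint together with its label (direction).
Edge : ℕ → Set
Edge n = Vertex n × Fin n

edgesAux : ∀ {n} → List (Fin n) → List (Fin n) → List (Edge n)
edgesAux pre []       = []
edgesAux pre (x ∷ xs) = (vertexOf pre , x) ∷ edgesAux (pre ++ [ x ]) xs

edgesOfPath : ∀ {n} → List (Fin n) → List (Edge n)
edgesOfPath = edgesAux []

leftPath : (n : ℕ) → List (Fin n)
leftPath n = allFin n

rightPath : ∀ {n} → Permutation′ n → List (Fin n)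
rightPath {n} w = map (w ⟨$⟩ʳ_) (allFin n)

BoundaryEdge : ∀ {n} → Permutation′ n → Edge n → Set
BoundaryEdge {n} w e = e ∈ edgesOfPath (leftPath n) ⊎ e ∈ edgesOfPath (rightPath w)

-- A rhombus tile: its top vertex and its two edge labels i < j.
record Tile (n : ℕ) : Set where
  constructor tile
  field
    top : Vertex n
    lo  : Fin n
    hi  : Fin n
open Tile public

-- A rhombic tiling of X(w) is given by sweeping the region from the left
-- boundary to the right boundary, flipping one rhombus at a time
-- (a path  .. i j ..  with i < j becomes  .. j i ..); the tiling is the list
-- of the rhombi swept.  `Sweep p q ts` : the region between paths p and q
-- is tiled by the rhombi ts.
data Sweep {n : ℕ} : List (Fin n) → List (Fin n) → List (Tile n) → Set where
  done : ∀ {p} → Sweep p p []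
  flip : ∀ {q ts} (xs ys : List (Fin n)) (i j : Fin n) → i <ᶠ j →
         Sweep (xs ++ j ∷ i ∷ ys) q ts →
         Sweep (xs ++ i ∷ j ∷ ys) q (tile (vertexOf xs) i j ∷ ts)

RhombicTiling : ∀ {n} → Permutation′ n → List (Tile n) → Set
RhombicTiling {n} w ts = Sweep (leftPath n) (rightPath w) ts

-- The four edges of a tile with top vertex p and labels i, j:
--   A = p → p+e_i,  B = p → p+e_j,  C = p+e_i → p+e_i+e_j,  D = p+e_j → p+e_i+e_j
edgeA edgeB edgeC edgeD : ∀ {n} → Tile n → Edge n
edgeA (tile p i j) = (p , i)
edgeB (tile p i j) = (p , j)
edgeC (tile p i j) = (step i p , j)
edgeD (tile p i j) = (step j p , i)

-- (strong) perimeter tile: two edges of the tile meeting at a common vertex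
-- (i.e. a path of two of its edges) both lie on the boundary of X(w).
PerimeterTile : ∀ {n} → Permutation′ n → Tile n → Set
PerimeterTile w t =
    (BoundaryEdge w (edgeA t) × BoundaryEdge w (edgeB t))
  ⊎ (BoundaryEdge w (edgeA t) × BoundaryEdge w (edgeC t))
  ⊎ (BoundaryEdge w (edgeB t) × BoundaryEdge w (edgeD t))
  ⊎ (BoundaryEdge w (edgeC t) × BoundaryEdge w (edgeD t))

ExactlyTwo : ∀ {A : Set} → (A → Set) → List A → Set
ExactlyTwo {A} P ts =
  Σ A λ a → Σ A λ b → a ≢ b × a ∈ ts × b ∈ ts × P a × P b ×
    (∀ c → c ∈ ts → P c → c ≡ a ⊎ c ≡ b)

-- {w(1),..,w(r)} = {1,..,r}  (0-indexed)
PrefixStable : ∀ {n} → Permutation′ n → ℕ → Set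
PrefixStable {n} w r =
  (∀ (k : Fin n) → toℕ k < r → toℕ (w ⟨$⟩ʳ k) < r) ×
  (∀ (m : Fin n) → toℕ m < r → Σ (Fin n) λ k → toℕ k < r × w ⟨$⟩ʳ k ≡ m)

-- w = n 1 2 ... (n-1) in one-line notation (0-indexed: 0 ↦ n-1, k+1 ↦ k)
shiftDown : ℕ → ℕ → ℕ
shiftDown n zero    = n ∸ 1
shiftDown n (suc k) = k

-- w = 2 3 ... n 1 in one-line notation (0-indexed: k ↦ k+1 for k < n-1, n-1 ↦ 0)
shiftUp : ℕ → ℕ → ℕ
shiftUp n k with suc k Data.Nat.≟ n
... | Relation.Nullary.yes _ = 0
... | Relation.Nullary.no  _ = suc k

{-# OPTIONS --safe #-}
-- A tile fitting a corner of the
-- left (right) boundary is a perimeter tile; the first (last) flip of every sweep is such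
-- a tile, and the two differ: a tile on both sides would give a vertex common to both
-- boundaries, i.e. a stable prefix of w.
--
-- For the two shifts one label x is first on one boundary and last on the other.  A flip
-- never undoes an inversion, so every tile swaps x with a neighbour, and a perimeter tile
-- must have an x-edge on the boundary, which exists only at the two ends: exactly two
-- perimeter tiles.
--
-- Conversely, compare the right boundary with 1,…,n-1.  Either it is 1,…,n-1,0 (the
-- upward shift), or after a common prefix P it has a label y ≠ 0 (y = 0 would give a
-- stable prefix) that occurs in the left boundary 0 P Q y R after a nonempty block Q.
-- Build the sweep that moves 0 past P, then y past 0 Q, and is then completed arbitrarily.
-- Its first flip, the flip of y with the last label of Q, and its last flip are three
-- distinct perimeter tiles; when P is empty the flip of y with 0 serves as the first one,
-- and when the completion is empty it serves as the last one.  If both are empty the right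
-- boundary is y 0 Q R, so R is empty (else there is a stable prefix) and w is the
-- downward shift.

module Submission where

open import Defs
open import Data.Nat as ℕ using (ℕ; zero; suc; _+_; _<_; _≤_; z≤n; z<s; s<s)
import Data.Nat.Properties as ℕ
open import Data.Fin as Fin using (Fin; toℕ; fromℕ; inject₁) renaming (_<_ to _<ᶠ_)
import Data.Fin.Properties as Fin
open import Data.Fin.Permutation using (Permutation′; _⟨$⟩ʳ_; _⟨$⟩ˡ_; inverseʳ)
open import Data.List using (List; []; _∷_; _++_; [_]; _∷ʳ_; map; allFin; tabulate; length)
open import Data.List.Properties using (++-assoc; ++-identityʳ; map-++; length-++; length-map; length-tabulate; map-tabulate; map-∘; map-cong; ∷-injective; ∷ʳ-injective)
open import Data.List.Membership.Propositional using (_∈_; _∉_)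
open import Data.List.Membership.Propositional.Properties using (∈-allFin; ∈-map⁺; ∈-map⁻; ∈-++⁺ˡ; ∈-++⁺ʳ; ∈-++⁻; ∈-∃++)
open import Data.List.Relation.Binary.Subset.Propositional using (_⊆_)
open import Data.List.Relation.Binary.Permutation.Propositional using (_↭_; ↭-refl; ↭-sym; ↭-trans; ↭-prep; ↭-swap; ↭⇒↭ₛ)
import Data.List.Relation.Binary.Permutation.Propositional.Properties as ↭
import Data.List.Relation.Binary.Permutation.Setoid.Properties as ↭ₛ
open import Data.List.Relation.Unary.Any as Any using (here; there)
open import Data.List.Relation.Unary.All as All using (All; []; _∷_)
import Data.List.Relation.Unary.All.Properties as All
open import Data.List.Relation.Unary.AllPairs as AllPairs using (AllPairs; []; _∷_)
open import Data.List.Relation.Unary.Unique.Propositional using (Unique)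
import Data.List.Relation.Unary.Unique.Propositional.Properties as Unique
open import Data.Vec using ([]; _∷_; lookup; replicate; sum)
import Data.Vec.Properties as Vec
open import Data.Product using (_×_; _,_; ∃; ∃₂; Σ; proj₁; proj₂)
open import Data.Sum using (_⊎_; inj₁; inj₂; swap; [_,_]′)
open import Data.Empty using (⊥; ⊥-elim)
open import Function using (_∘_; case_of_; _⇔_; mk⇔; Equivalence; Injection)
open import Function.Properties.Inverse using (↔⇒↣)
open import Relation.Binary.PropositionalEquality using (_≡_; _≢_; refl; sym; trans; cong; cong₂; subst; setoid; module ≡-Reasoning)
open import Relation.Binary.Definitions using (DecidableEquality)
open import Relation.Nullary using (¬_; yes; no)

private
  variable
    A B : Set
    n : ℕ

module _ {R : A → A → Set} where

  AllPairs-++⁻ʳ : ∀ xs {ys} → AllPairs R (xs ++ ys) → AllPairs R ys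
  AllPairs-++⁻ʳ []       rs        = rs
  AllPairs-++⁻ʳ (_ ∷ xs) (_ ∷ rs) = AllPairs-++⁻ʳ xs rs

  AllPairs-++⇒R : ∀ xs {ys x y} → AllPairs R (xs ++ ys) → x ∈ xs → y ∈ ys → R x y
  AllPairs-++⇒R (_ ∷ xs) (rx ∷ _)  (here refl) y∈ = All.lookup (proj₂ (All.++⁻ xs rx)) y∈
  AllPairs-++⇒R (_ ∷ xs) (_  ∷ rs) (there x∈)  y∈ = AllPairs-++⇒R xs rs x∈ y∈

  AllPairs-removeMiddle : ∀ xs ys {zs} → AllPairs R (xs ++ ys ++ zs) → AllPairs R (xs ++ zs)
  AllPairs-removeMiddle []       ys rs        = AllPairs-++⁻ʳ ys rs
  AllPairs-removeMiddle (_ ∷ xs) ys (rx ∷ rs) =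
    All.++⁺ (proj₁ (All.++⁻ xs rx)) (proj₂ (All.++⁻ ys (proj₂ (All.++⁻ xs rx))))
    ∷ AllPairs-removeMiddle xs ys rs

  AllPairs-tabulate⁺ : {f : Fin n → A} → (∀ {i j} → i <ᶠ j → R (f i) (f j)) → AllPairs R (tabulate f)
  AllPairs-tabulate⁺ {n = zero}  mono = []
  AllPairs-tabulate⁺ {n = suc n} mono = All.tabulate⁺ (λ _ → mono z<s) ∷ AllPairs-tabulate⁺ (mono ∘ s<s)

Unique-∷⇒∉ : ∀ {x : A} {xs} → Unique (x ∷ xs) → x ∉ xs
Unique-∷⇒∉ (x≢xs ∷ _) = All.All¬⇒¬Any x≢xs

Unique-++⇒∉ : ∀ xs {ys} {x : A} → Unique (xs ++ ys) → x ∈ xs → x ∉ ys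
Unique-++⇒∉ xs u x∈xs x∈ys = AllPairs-++⇒R xs u x∈xs x∈ys refl

Unique-resp-↭ : {xs ys : List A} → xs ↭ ys → Unique xs → Unique ys
Unique-resp-↭ {A} xs↭ys = ↭ₛ.Unique-resp-↭ (setoid A) (↭⇒↭ₛ xs↭ys)

Unique-⊆-⊇⇒↭ : ∀ {xs ys : List A} → Unique xs → Unique ys → xs ⊆ ys → ys ⊆ xs → xs ↭ ys
Unique-⊆-⊇⇒↭ {xs = []} {[]}    _ _ _ _ = ↭-refl
Unique-⊆-⊇⇒↭ {xs = []} {_ ∷ _} _ _ _ ys⊆xs with ys⊆xs (here refl)
... | ()
Unique-⊆-⊇⇒↭ {xs = x ∷ xs} uxs uys xs⊆ys ys⊆xs with as , bs , refl ← ∈-∃++ (xs⊆ys (here refl)) =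
  ↭-trans (↭-prep x (Unique-⊆-⊇⇒↭ (AllPairs-++⁻ʳ [ x ] uxs) (AllPairs-++⁻ʳ [ x ] uys′) sub sup)) (↭-sym shifted)
  where
  shifted : as ++ [ x ] ++ bs ↭ x ∷ as ++ bs
  shifted = ↭.shift x as bs
  uys′ : Unique (x ∷ as ++ bs)
  uys′ = Unique-resp-↭ shifted uys
  sub : xs ⊆ as ++ bs
  sub z∈xs with ↭.∈-resp-↭ shifted (xs⊆ys (there z∈xs))
  ... | here refl  = ⊥-elim (Unique-∷⇒∉ uxs z∈xs)
  ... | there z∈′ = z∈′
  sup : as ++ bs ⊆ xs
  sup z∈ with ys⊆xs (↭.∈-resp-↭ (↭-sym shifted) (there z∈))
  ... | here refl  = ⊥-elim (Unique-∷⇒∉ uys′ z∈)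
  ... | there z∈′ = z∈′

split-injective : ∀ {x : A} as bs cs ds → x ∉ as → x ∉ bs →
                  as ++ x ∷ bs ≡ cs ++ x ∷ ds → as ≡ cs × bs ≡ ds
split-injective []       bs []       ds _   _   refl = refl , refl
split-injective []       bs (c ∷ cs) ds _   x∉bs refl = ⊥-elim (x∉bs (∈-++⁺ʳ cs (here refl)))
split-injective (a ∷ as) bs []       ds x∉as _   refl = ⊥-elim (x∉as (here refl))
split-injective (a ∷ as) bs (c ∷ cs) ds x∉as x∉bs eq with refl , eq′ ← ∷-injective eq
  with refl , refl ← split-injective as bs cs ds (x∉as ∘ there) x∉bs eq′ = refl , refl

++-∷≢[] : ∀ (xs : List A) {x ys} → xs ++ x ∷ ys ≢ []
++-∷≢[] []      ()
++-∷≢[] (_ ∷ _) ()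

∉-++⁻ : ∀ {x : A} as {bs} → x ∉ as ++ bs → x ∉ as × x ∉ bs
∉-++⁻ as x∉ = x∉ ∘ ∈-++⁺ˡ , x∉ ∘ ∈-++⁺ʳ as

swap-↭ : ∀ (xs : List A) {i j ys} → xs ++ i ∷ j ∷ ys ↭ xs ++ j ∷ i ∷ ys
swap-↭ xs = ↭.++⁺ˡ xs (↭-swap _ _ ↭-refl)

↭-++-cancelˡ : ∀ (xs : List A) {ys zs} → xs ++ ys ↭ xs ++ zs → ys ↭ zs
↭-++-cancelˡ []       ys↭zs = ys↭zs
↭-++-cancelˡ (_ ∷ xs) ys↭zs = ↭-++-cancelˡ xs (↭.drop-∷ ys↭zs)

map-≡⇒pointwise : ∀ {f g : A → B} xs → map f xs ≡ map g xs → ∀ {x} → x ∈ xs → f x ≡ g x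
map-≡⇒pointwise (_ ∷ _)  eq (here refl) = proj₁ (∷-injective eq)
map-≡⇒pointwise (_ ∷ xs) eq (there x∈)  = map-≡⇒pointwise xs (proj₂ (∷-injective eq)) x∈

map-≡-++ : ∀ (f : A → B) zs xs ys → map f zs ≡ xs ++ ys →
           ∃₂ λ as bs → zs ≡ as ++ bs × map f as ≡ xs × map f bs ≡ ys
map-≡-++ f zs       []       ys eq = [] , zs , refl , refl , eq
map-≡-++ f (z ∷ zs) (x ∷ xs) ys eq with refl , eq′ ← ∷-injective eq
  with as , bs , refl , refl , refl ← map-≡-++ f zs xs ys eq′ = z ∷ as , bs , refl , refl , refl

∷⇒∷ʳ : ∀ (l : A) L → ∃₂ λ Lᵢ lₗ → l ∷ L ≡ Lᵢ ∷ʳ lₗ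
∷⇒∷ʳ l []      = [] , l , refl
∷⇒∷ʳ l (l′ ∷ L) with Lᵢ , lₗ , eq ← ∷⇒∷ʳ l′ L = l ∷ Lᵢ , lₗ , cong (l ∷_) eq

data Divergence (xs ys : List A) : Set where
  diverge : ∀ P y W r R → xs ≡ P ++ y ∷ W → ys ≡ P ++ r ∷ R → y ≢ r → Divergence xs ys

firstDifference : DecidableEquality A → ∀ (xs ys : List A) → length xs ≡ suc (length ys) →
                  (∃ λ y → xs ≡ ys ∷ʳ y) ⊎ Divergence xs ys
firstDifference _≟_ (x ∷ []) []       _    = inj₁ (x , refl)
firstDifference _≟_ (x ∷ xs) (r ∷ ys) |xs| with x ≟ r
... | no  x≢r  = inj₂ (diverge [] x xs r ys refl refl x≢r)
... | yes refl with firstDifference _≟_ xs ys (ℕ.suc-injective |xs|)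
...   | inj₁ (y , refl) = inj₁ (y , refl)
...   | inj₂ (diverge P y W r′ R refl refl y≢r′) = inj₂ (diverge (x ∷ P) y W r′ R refl refl y≢r′)

AtMostTwo : (A → Set) → Set
AtMostTwo {A} P = ∃₂ λ (u v : A) → ∀ c → P c → c ≡ u ⊎ c ≡ v

AtMostTwo-mono : ∀ {P Q : A → Set} → (∀ {c} → P c → Q c) → AtMostTwo Q → AtMostTwo P
AtMostTwo-mono P⇒Q (u , v , only) = u , v , λ c → only c ∘ P⇒Q

atMostTwo⇒exactlyTwo : ∀ {P : A → Set} {ts a b} → AtMostTwo (λ c → c ∈ ts × P c) →
  a ≢ b → a ∈ ts → b ∈ ts → P a → P b → ExactlyTwo P ts
atMostTwo⇒exactlyTwo {P = P} {ts} {a} {b} (u , v , only) a≢b a∈ b∈ pa pb =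
  a , b , a≢b , a∈ , b∈ , pa , pb , onlyAB
  where
  onlyAB : ∀ c → c ∈ ts → P c → c ≡ a ⊎ c ≡ b
  onlyAB c c∈ pc with only a (a∈ , pa) | only b (b∈ , pb) | only c (c∈ , pc)
  ... | inj₁ refl | inj₁ refl | _         = ⊥-elim (a≢b refl)
  ... | inj₂ refl | inj₂ refl | _         = ⊥-elim (a≢b refl)
  ... | inj₁ refl | inj₂ refl | c≡a       = c≡a
  ... | inj₂ refl | inj₁ refl | inj₁ c≡b  = inj₂ c≡b
  ... | inj₂ refl | inj₁ refl | inj₂ c≡a  = inj₁ c≡a

exactlyTwo⇒atMostTwo : ∀ {P : A → Set} {ts} → ExactlyTwo P ts → AtMostTwo (λ c → c ∈ ts × P c)
exactlyTwo⇒atMostTwo (a , b , _ , _ , _ , _ , _ , only) = a , b , λ c (c∈ , pc) → only c c∈ pc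

atMostTwo-¬three : ∀ {P : A → Set} {a b c} → AtMostTwo P → a ≢ b → a ≢ c → b ≢ c → P a → P b → P c → ⊥
atMostTwo-¬three (u , v , only) a≢b a≢c b≢c pa pb pc with only _ pa | only _ pb | only _ pc
... | inj₁ refl | inj₁ refl | _         = a≢b refl
... | inj₂ refl | inj₂ refl | _         = a≢b refl
... | inj₁ refl | _         | inj₁ refl = a≢c refl
... | inj₂ refl | _         | inj₂ refl = a≢c refl
... | _         | inj₁ refl | inj₁ refl = b≢c refl
... | _         | inj₂ refl | inj₂ refl = b≢c refl

EndPosition : (List A → A → B) → List A → B → Set
EndPosition f L b = ∃₂ λ as j → ∃ λ bs → L ≡ as ++ j ∷ bs × (as ≡ [] ⊎ bs ≡ []) × b ≡ f as j

EndPosition-atMostTwo : ∀ (f : List A → A → B) l L → AtMostTwo (EndPosition f (l ∷ L))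
EndPosition-atMostTwo f l L with Lᵢ , lₗ , l∷L≡ ← ∷⇒∷ʳ l L = f [] l , f Lᵢ lₗ , onlyEnds l∷L≡
  where
  onlyEnds : ∀ {Lᵢ lₗ} → l ∷ L ≡ Lᵢ ∷ʳ lₗ → ∀ b → EndPosition f (l ∷ L) b → b ≡ f [] l ⊎ b ≡ f Lᵢ lₗ
  onlyEnds _     b ([] , j , bs , refl , _ , refl) = inj₁ refl
  onlyEnds l∷L≡ b (as , j , [] , L≡ , _ , refl) with refl , refl ← ∷ʳ-injective as _ (trans (sym L≡) l∷L≡) = inj₂ refl
  onlyEnds _     b (_ ∷ _ , j , _ ∷ _ , _ , inj₁ () , _)
  onlyEnds _     b (_ ∷ _ , j , _ ∷ _ , _ , inj₂ () , _)

Sorted : List (Fin n) → Set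
Sorted = AllPairs _<ᶠ_

allFin-sorted : ∀ n → Sorted (allFin n)
allFin-sorted n = AllPairs-tabulate⁺ (λ i<j → i<j)

length-allFin : ∀ n → length (allFin n) ≡ n
length-allFin n = length-tabulate (λ i → i)

allFin-suc : ∀ m → allFin (suc m) ≡ Fin.zero ∷ map Fin.suc (allFin m)
allFin-suc m = cong (Fin.zero ∷_) (sym (map-tabulate (λ i → i) Fin.suc))

allFin-∷ʳ : ∀ m → allFin (suc m) ≡ map inject₁ (allFin m) ∷ʳ fromℕ m
allFin-∷ʳ zero    = refl
allFin-∷ʳ (suc m) = begin
  -- the two middle steps swap the maps: Fin.suc ∘ inject₁ is inject₁ ∘ Fin.suc by definition
  allFin (suc (suc m))                                               ≡⟨ allFin-suc (suc m) ⟩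
  Fin.zero ∷ map Fin.suc (allFin (suc m))                            ≡⟨ cong (λ xs → Fin.zero ∷ map Fin.suc xs) (allFin-∷ʳ m) ⟩
  Fin.zero ∷ map Fin.suc (map inject₁ (allFin m) ∷ʳ fromℕ m)         ≡⟨ cong (Fin.zero ∷_) (map-++ Fin.suc _ [ fromℕ m ]) ⟩
  Fin.zero ∷ map Fin.suc (map inject₁ (allFin m)) ∷ʳ fromℕ (suc m)   ≡⟨ cong (λ xs → Fin.zero ∷ xs ∷ʳ fromℕ (suc m)) (sym (map-∘ (allFin m))) ⟩
  Fin.zero ∷ map (Fin.suc ∘ inject₁) (allFin m) ∷ʳ fromℕ (suc m)     ≡⟨ cong (λ xs → Fin.zero ∷ xs ∷ʳ fromℕ (suc m)) (map-∘ (allFin m)) ⟩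
  map inject₁ (Fin.zero ∷ map Fin.suc (allFin m)) ∷ʳ fromℕ (suc m)   ≡⟨ cong (λ xs → map inject₁ xs ∷ʳ fromℕ (suc m)) (sym (allFin-suc m)) ⟩
  map inject₁ (allFin (suc m)) ∷ʳ fromℕ (suc m)                      ∎
  where open ≡-Reasoning

allFin-prefix : ∀ as {bs} → allFin n ≡ as ++ bs → ∀ k → k ∈ as ⇔ toℕ k < length as
allFin-prefix []                  _  k = mk⇔ (λ ()) (λ ())
allFin-prefix {zero}  (a ∷ as)    ()
allFin-prefix {suc n} (a ∷ as) {bs} eq k with refl , eq′ ← ∷-injective (trans (sym (allFin-suc n)) eq)
  with cs , ds , allFin≡ , refl , refl ← map-≡-++ Fin.suc (allFin n) as bs eq′ = mk⇔ to from
  where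
  |cs| : length (map Fin.suc cs) ≡ length cs
  |cs| = length-map Fin.suc cs
  to : ∀ {k} → k ∈ Fin.zero ∷ map Fin.suc cs → toℕ k < suc (length (map Fin.suc cs))
  to (here refl) = z<s
  to (there k∈) with k′ , k′∈ , refl ← ∈-map⁻ Fin.suc k∈ =
    s<s (subst (toℕ k′ <_) (sym |cs|) (Equivalence.to (allFin-prefix cs allFin≡ k′) k′∈))
  from : ∀ {k} → toℕ k < suc (length (map Fin.suc cs)) → k ∈ Fin.zero ∷ map Fin.suc cs
  from {Fin.zero}  _        = here refl
  from {Fin.suc k} (s<s lt) =
    there (∈-map⁺ Fin.suc (Equivalence.from (allFin-prefix cs allFin≡ k) (subst (toℕ k <_) |cs| lt)))

-- Vertices and boundary edges

step-comm : ∀ (i j : Fin n) v → step i (step j v) ≡ step j (step i v)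
step-comm i j v with i Fin.≟ j
... | yes refl = refl
... | no i≢j   = Vec.updateAt-commutes i j i≢j v

vertexOf-++-∷ : ∀ (xs : List (Fin n)) a ys → vertexOf (xs ++ a ∷ ys) ≡ step a (vertexOf (xs ++ ys))
vertexOf-++-∷ []       a ys = refl
vertexOf-++-∷ (x ∷ xs) a ys = trans (cong (step x) (vertexOf-++-∷ xs a ys)) (step-comm x a _)

vertexOf-∷ʳ : ∀ (xs : List (Fin n)) a → vertexOf (xs ∷ʳ a) ≡ step a (vertexOf xs)
vertexOf-∷ʳ xs a = trans (vertexOf-++-∷ xs a []) (cong (step a ∘ vertexOf) (++-identityʳ xs))

translate : List (Fin n) → Vertex n → Vertex n
translate []       v = v
translate (x ∷ xs) v = step x (translate xs v)

vertexOf-++ : ∀ (xs ys : List (Fin n)) → vertexOf (xs ++ ys) ≡ translate xs (vertexOf ys)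
vertexOf-++ []       ys = refl
vertexOf-++ (x ∷ xs) ys = cong (step x) (vertexOf-++ xs ys)

lookup-vertexOf-∈ : ∀ {x : Fin n} {xs} → x ∈ xs → 0 < lookup (vertexOf xs) x
lookup-vertexOf-∈ {x = x} {y ∷ xs} x∈ with y Fin.≟ x
... | yes refl = subst (0 <_) (sym (Vec.lookup∘updateAt x (vertexOf xs))) z<s
... | no  y≢x  = subst (0 <_) (sym (Vec.lookup∘updateAt′ x y (y≢x ∘ sym) (vertexOf xs)))
                   (lookup-vertexOf-∈ (Any.tail (y≢x ∘ sym) x∈))

lookup-vertexOf-∉ : ∀ {x : Fin n} {xs} → x ∉ xs → lookup (vertexOf xs) x ≡ 0
lookup-vertexOf-∉ {x = x} {[]}     _    = Vec.lookup-replicate x 0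
lookup-vertexOf-∉ {x = x} {y ∷ xs} x∉xs =
  trans (Vec.lookup∘updateAt′ x y (λ x≡y → x∉xs (here x≡y)) (vertexOf xs)) (lookup-vertexOf-∉ (x∉xs ∘ there))

vertexOf-⊆ : ∀ {xs ys : List (Fin n)} → vertexOf xs ≡ vertexOf ys → xs ⊆ ys
vertexOf-⊆ {xs = xs} {ys} eq {x} x∈xs with Any.any? (x Fin.≟_) ys
... | yes x∈ys = x∈ys
... | no  x∉ys = ⊥-elim (ℕ.<⇒≢ (lookup-vertexOf-∈ x∈xs) (sym (trans (cong (λ v → lookup v x) eq) (lookup-vertexOf-∉ x∉ys))))

vertexOf-≡[] : ∀ {xs : List (Fin n)} → vertexOf xs ≡ vertexOf [] → xs ≡ []
vertexOf-≡[] {xs = []}    _  = refl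
vertexOf-≡[] {xs = x ∷ xs} eq with vertexOf-⊆ {xs = x ∷ xs} {ys = []} eq (here refl)
... | ()

sum-step : ∀ (i : Fin n) v → sum (step i v) ≡ suc (sum v)
sum-step Fin.zero    (x ∷ v) = refl
sum-step (Fin.suc i) (x ∷ v) = trans (cong (x +_) (sum-step i v)) (ℕ.+-suc x (sum v))

sum-replicate-0 : ∀ n → sum (replicate n 0) ≡ 0
sum-replicate-0 zero    = refl
sum-replicate-0 (suc n) = sum-replicate-0 n

sum-vertexOf : ∀ (xs : List (Fin n)) → sum (vertexOf xs) ≡ length xs
sum-vertexOf {n} []       = sum-replicate-0 n
sum-vertexOf     (x ∷ xs) = trans (sum-step x (vertexOf xs)) (cong suc (sum-vertexOf xs))

vertexOf-length : ∀ (xs ys : List (Fin n)) → vertexOf xs ≡ vertexOf ys → length xs ≡ length ys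
vertexOf-length xs ys eq = trans (sym (sum-vertexOf xs)) (trans (cong sum eq) (sum-vertexOf ys))

∈-edgesAux⁺ : ∀ (pre as : List (Fin n)) l bs → (vertexOf (pre ++ as) , l) ∈ edgesAux pre (as ++ l ∷ bs)
∈-edgesAux⁺ pre []       l bs = here (cong (λ v → v , l) (cong vertexOf (++-identityʳ pre)))
∈-edgesAux⁺ pre (a ∷ as) l bs = there (subst (λ v → (v , l) ∈ edgesAux (pre ∷ʳ a) (as ++ l ∷ bs))
                                           (cong vertexOf (++-assoc pre [ a ] as)) (∈-edgesAux⁺ (pre ∷ʳ a) as l bs))

∈-edgesAux⁻ : ∀ (pre xs : List (Fin n)) {v l} → (v , l) ∈ edgesAux pre xs →
              ∃₂ λ as bs → xs ≡ as ++ l ∷ bs × v ≡ vertexOf (pre ++ as)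
∈-edgesAux⁻ pre (x ∷ xs) (here refl) = [] , xs , refl , cong vertexOf (sym (++-identityʳ pre))
∈-edgesAux⁻ pre (x ∷ xs) (there e∈) with as , bs , refl , refl ← ∈-edgesAux⁻ (pre ∷ʳ x) xs e∈ =
  x ∷ as , bs , refl , cong vertexOf (++-assoc pre [ x ] as)

∈-edgesOfPath⁺ : ∀ {p : List (Fin n)} as l bs → p ≡ as ++ l ∷ bs → (vertexOf as , l) ∈ edgesOfPath p
∈-edgesOfPath⁺ as l bs refl = ∈-edgesAux⁺ [] as l bs

∈-edgesOfPath⁻ : ∀ (p : List (Fin n)) {v l} → (v , l) ∈ edgesOfPath p →
                 ∃₂ λ as bs → p ≡ as ++ l ∷ bs × v ≡ vertexOf as
∈-edgesOfPath⁻ p = ∈-edgesAux⁻ [] p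

edgesOfPath-uniqueLabel : ∀ {p : List (Fin n)} {x} cs ds → p ≡ cs ++ x ∷ ds → x ∉ cs → x ∉ ds →
                          ∀ {v} → (v , x) ∈ edgesOfPath p → v ≡ vertexOf cs
edgesOfPath-uniqueLabel {p = p} cs ds p≡ x∉cs x∉ds e∈ with as , bs , p≡′ , refl ← ∈-edgesOfPath⁻ p e∈
  with refl , refl ← split-injective cs ds as bs x∉cs x∉ds (trans (sym p≡) p≡′) = refl

consecutiveEdges : ∀ {p : List (Fin n)} as i j bs → p ≡ as ++ i ∷ j ∷ bs →
                   (vertexOf as , i) ∈ edgesOfPath p × (step i (vertexOf as) , j) ∈ edgesOfPath p
consecutiveEdges as i j bs p≡ =
  ∈-edgesOfPath⁺ as i (j ∷ bs) p≡ ,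
  subst (λ v → (v , j) ∈ edgesOfPath _) (vertexOf-∷ʳ as i)
        (∈-edgesOfPath⁺ (as ∷ʳ i) j bs (trans p≡ (sym (++-assoc as [ i ] (j ∷ bs)))))

leftPath-unique : ∀ n → Unique (leftPath n)
leftPath-unique = Unique.allFin⁺

rightPath-unique : ∀ (w : Permutation′ n) → Unique (rightPath w)
rightPath-unique {n} w = Unique.map⁺ (Injection.injective (↔⇒↣ w)) (Unique.allFin⁺ n)

length-rightPath : ∀ (w : Permutation′ n) → length (rightPath w) ≡ n
length-rightPath {n} w = trans (length-map _ (allFin n)) (length-allFin n)

rightPath-complete : ∀ (w : Permutation′ n) x → x ∈ rightPath w
rightPath-complete w x = subst (_∈ rightPath w) (inverseʳ w) (∈-map⁺ (w ⟨$⟩ʳ_) (∈-allFin (w ⟨$⟩ˡ x)))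

rightPath↭leftPath : ∀ (w : Permutation′ n) → rightPath w ↭ leftPath n
rightPath↭leftPath {n} w =
  Unique-⊆-⊇⇒↭ (rightPath-unique w) (leftPath-unique n) (λ _ → ∈-allFin _) (λ _ → rightPath-complete w _)

LeftCorner RightCorner : List (Fin n) → Tile n → Set
LeftCorner  p t = ∃₂ λ xs ys → p ≡ xs ++ lo t ∷ hi t ∷ ys × top t ≡ vertexOf xs
RightCorner p t = ∃₂ λ xs ys → p ≡ xs ++ hi t ∷ lo t ∷ ys × top t ≡ vertexOf xs

leftCorner⇒perimeter : ∀ (w : Permutation′ n) {t} → LeftCorner (leftPath n) t → PerimeterTile w t
leftCorner⇒perimeter w {tile _ i j} (xs , ys , p≡ , refl) =
  let a , c = consecutiveEdges xs i j ys p≡ in inj₂ (inj₁ (inj₁ a , inj₁ c))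

rightCorner⇒perimeter : ∀ (w : Permutation′ n) {t} → RightCorner (rightPath w) t → PerimeterTile w t
rightCorner⇒perimeter w {tile _ i j} (xs , ys , p≡ , refl) =
  let b , d = consecutiveEdges xs j i ys p≡ in inj₂ (inj₂ (inj₁ (inj₂ b , inj₂ d)))

perimeter-loEdge : ∀ {w : Permutation′ n} {c} → PerimeterTile w c → BoundaryEdge w (edgeA c) ⊎ BoundaryEdge w (edgeD c)
perimeter-loEdge (inj₁ (a , _))               = inj₁ a
perimeter-loEdge (inj₂ (inj₁ (a , _)))        = inj₁ a
perimeter-loEdge (inj₂ (inj₂ (inj₁ (_ , d)))) = inj₂ d
perimeter-loEdge (inj₂ (inj₂ (inj₂ (_ , d)))) = inj₂ d

perimeter-hiEdge : ∀ {w : Permutation′ n} {c} → PerimeterTile w c → BoundaryEdge w (edgeB c) ⊎ BoundaryEdge w (edgeC c)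
perimeter-hiEdge (inj₁ (_ , b))               = inj₁ b
perimeter-hiEdge (inj₂ (inj₁ (_ , c)))        = inj₂ c
perimeter-hiEdge (inj₂ (inj₂ (inj₁ (b , _)))) = inj₁ b
perimeter-hiEdge (inj₂ (inj₂ (inj₂ (c , _)))) = inj₂ c

PerimeterTileOf : Permutation′ n → List (Tile n) → Tile n → Set
PerimeterTileOf w ts c = c ∈ ts × PerimeterTile w c

-- Stable prefixes

commonVertex⇒PrefixStable : ∀ (w : Permutation′ n) {as as′ xs xs′} →
  leftPath n ≡ as ++ as′ → rightPath w ≡ xs ++ xs′ → vertexOf as ≡ vertexOf xs → PrefixStable w (length xs)
commonVertex⇒PrefixStable {n} w {as} {as′} {xs} {xs′} left≡ right≡ as≈xs
  with cs , ds , allFin≡ , refl , refl ← map-≡-++ (w ⟨$⟩ʳ_) (allFin n) xs xs′ right≡ = closed , onto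
  where
  |cs| : length (map (w ⟨$⟩ʳ_) cs) ≡ length cs
  |cs| = length-map (w ⟨$⟩ʳ_) cs
  |as| : length as ≡ length (map (w ⟨$⟩ʳ_) cs)
  |as| = vertexOf-length as (map (w ⟨$⟩ʳ_) cs) as≈xs
  closed : ∀ k → toℕ k < length (map (w ⟨$⟩ʳ_) cs) → toℕ (w ⟨$⟩ʳ k) < length (map (w ⟨$⟩ʳ_) cs)
  closed k k< =
    let k∈cs = Equivalence.from (allFin-prefix cs allFin≡ k) (subst (toℕ k <_) |cs| k<)
        wk∈as = vertexOf-⊆ (sym as≈xs) (∈-map⁺ (w ⟨$⟩ʳ_) k∈cs)
    in subst (toℕ (w ⟨$⟩ʳ k) <_) |as| (Equivalence.to (allFin-prefix as left≡ _) wk∈as)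
  onto : ∀ m → toℕ m < length (map (w ⟨$⟩ʳ_) cs) → Σ (Fin n) λ k → toℕ k < length (map (w ⟨$⟩ʳ_) cs) × w ⟨$⟩ʳ k ≡ m
  onto m m< with k , k∈cs , refl ← ∈-map⁻ (w ⟨$⟩ʳ_)
                   (vertexOf-⊆ as≈xs (Equivalence.from (allFin-prefix as left≡ m) (subst (toℕ m <_) (sym |as|) m<))) =
    k , subst (toℕ k <_) (sym |cs|) (Equivalence.to (allFin-prefix cs allFin≡ k) k∈cs) , refl

Indecomposable : Permutation′ n → Set
Indecomposable {n} w = ∀ r → 1 ≤ r → r < n → ¬ PrefixStable w r

noCommonVertex : ∀ {w : Permutation′ n} → Indecomposable w → ∀ as {a as′} xs {xs′} →
  leftPath n ≡ as ++ a ∷ as′ → rightPath w ≡ xs ++ xs′ → xs ≢ [] → vertexOf as ≢ vertexOf xs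
noCommonVertex {n} {w} indec as {a} {as′} (x ∷ xs) left≡ right≡ _ as≈xs =
  indec (length (x ∷ xs)) z<s |xs|<n (commonVertex⇒PrefixStable w {as} {xs = x ∷ xs} left≡ right≡ as≈xs)
  where
  |xs|<n : length (x ∷ xs) < n
  |xs|<n = begin-strict
    length (x ∷ xs)          ≡⟨ vertexOf-length as (x ∷ xs) as≈xs ⟨
    length as                <⟨ ℕ.m<m+n (length as) z<s ⟩
    length as + length (a ∷ as′) ≡⟨ length-++ as ⟨
    length (as ++ a ∷ as′)   ≡⟨ cong length left≡ ⟨
    length (allFin n)        ≡⟨ length-allFin n ⟩
    n                        ∎
    where open ℕ.≤-Reasoning
noCommonVertex indec _ [] _ _ xs≢[] _ = xs≢[] refl

leftPath≢rightPath : ∀ {w : Permutation′ n} → 1 < n → Indecomposable w → leftPath n ≢ rightPath w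
leftPath≢rightPath {suc (suc m)} {w} _ indec left≡right =
  noCommonVertex {w = w} indec [ Fin.zero ] [ Fin.zero ] refl (sym left≡right) (λ ()) refl
leftPath≢rightPath {suc zero} (s<s ())

leftCorner≢rightCorner : ∀ {w : Permutation′ n} → 2 < n → Indecomposable w → ∀ {s t} →
  LeftCorner (leftPath n) s → RightCorner (rightPath w) t → s ≢ t
leftCorner≢rightCorner {w = w} n>2 indec (as , bs , left≡ , refl) (x ∷ xs , ys , right≡ , as≈xs) refl =
  noCommonVertex {w = w} indec as (x ∷ xs) left≡ right≡ (λ ()) as≈xs
leftCorner≢rightCorner {n} n>2 indec (as , [] , left≡ , refl) ([] , ys , right≡ , as≈[]) refl
  with refl ← vertexOf-≡[] {xs = as} as≈[] =
  ℕ.<-irrefl (trans (sym (cong length left≡)) (length-allFin n)) n>2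
leftCorner≢rightCorner {n} {w} n>2 indec {tile _ i j} (as , b ∷ bs , left≡ , refl) ([] , ys , right≡ , as≈[]) refl
  with refl ← vertexOf-≡[] {xs = as} as≈[] =
  noCommonVertex {w = w} indec (i ∷ j ∷ []) (j ∷ i ∷ []) left≡ right≡ (λ ()) (step-comm i j _)

-- Sweeps

sweep-cast : ∀ {p p′ q q′ : List (Fin n)} {ts ts′} → p ≡ p′ → q ≡ q′ → ts ≡ ts′ → Sweep p q ts → Sweep p′ q′ ts′
sweep-cast refl refl refl s = s

sweep-++ : ∀ {p q r : List (Fin n)} {ts us} → Sweep p q ts → Sweep q r us → Sweep p r (ts ++ us)
sweep-++ done                   s′ = s′
sweep-++ (flip xs ys i j i<j s) s′ = flip xs ys i j i<j (sweep-++ s s′)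

translateTile : List (Fin n) → Tile n → Tile n
translateTile pre (tile v i j) = tile (translate pre v) i j

sweep-prefix : ∀ (pre : List (Fin n)) {p q ts} → Sweep p q ts → Sweep (pre ++ p) (pre ++ q) (map (translateTile pre) ts)
sweep-prefix pre done                   = done
sweep-prefix pre (flip xs ys i j i<j s) =
  sweep-cast (++-assoc pre xs (i ∷ j ∷ ys)) refl (cong (λ v → tile v i j ∷ _) (vertexOf-++ pre xs))
    (flip (pre ++ xs) ys i j i<j (sweep-cast (sym (++-assoc pre xs (j ∷ i ∷ ys))) refl refl (sweep-prefix pre s)))

RightCorner-prefix : ∀ (pre : List (Fin n)) {q t} → RightCorner q t → RightCorner (pre ++ q) (translateTile pre t)
RightCorner-prefix pre {t = tile v i j} (xs , ys , refl , refl) =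
  pre ++ xs , ys , sym (++-assoc pre xs _) , sym (vertexOf-++ pre xs)

sweep-firstTile : ∀ {p q : List (Fin n)} {ts} → Sweep p q ts → p ≡ q ⊎ ∃ λ t → t ∈ ts × LeftCorner p t
sweep-firstTile done                   = inj₁ refl
sweep-firstTile (flip xs ys i j i<j s) = inj₂ (_ , here refl , xs , ys , refl , refl)

sweep-lastTile : ∀ {p q : List (Fin n)} {ts} → Sweep p q ts → p ≡ q ⊎ ∃ λ t → t ∈ ts × RightCorner q t
sweep-lastTile done = inj₁ refl
sweep-lastTile (flip xs ys i j i<j s) with sweep-lastTile s
... | inj₁ refl                = inj₂ (_ , here refl , xs , ys , refl , refl)
... | inj₂ (t , t∈ts , corner) = inj₂ (t , there t∈ts , corner)

sweep-lo<hi : ∀ {p q : List (Fin n)} {ts} → Sweep p q ts → ∀ {c} → c ∈ ts → lo c <ᶠ hi c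
sweep-lo<hi (flip xs ys i j i<j s) (here refl) = i<j
sweep-lo<hi (flip xs ys i j i<j s) (there c∈)  = sweep-lo<hi s c∈

sweep⇒↭ : ∀ {p q : List (Fin n)} {ts} → Sweep p q ts → p ↭ q
sweep⇒↭ done                   = ↭-refl
sweep⇒↭ (flip xs ys i j i<j s) = ↭-trans (swap-↭ xs) (sweep⇒↭ s)

data Precedes (a b : Fin n) : List (Fin n) → Set where
  now   : ∀ {xs} → b ∈ xs → Precedes a b (a ∷ xs)
  later : ∀ {c xs} → Precedes a b xs → Precedes a b (c ∷ xs)

Precedes-swap : ∀ {a b : Fin n} xs {i j ys} → Precedes a b (xs ++ i ∷ j ∷ ys) → ¬ (a ≡ i × b ≡ j) →
                Precedes a b (xs ++ j ∷ i ∷ ys)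
Precedes-swap []       (now (here refl))     a≢i⊎b≢j = ⊥-elim (a≢i⊎b≢j (refl , refl))
Precedes-swap []       (now (there b∈ys))    _       = later (now b∈ys)
Precedes-swap []       (later (now b∈))      _       = now (there b∈)
Precedes-swap []       (later (later a≺b))   _       = later (later a≺b)
Precedes-swap (_ ∷ xs) (now b∈)              _       = now (↭.∈-resp-↭ (swap-↭ xs) b∈)
Precedes-swap (_ ∷ xs) (later a≺b)           ne      = later (Precedes-swap xs a≺b ne)

Precedes-at : ∀ (xs : List (Fin n)) {i j ys} → Precedes j i (xs ++ j ∷ i ∷ ys)
Precedes-at []       = now (here refl)
Precedes-at (_ ∷ xs) = later (Precedes-at xs)

sweep-preservesInversion : ∀ {p q : List (Fin n)} {ts} → Sweep p q ts → ∀ {a b} → b <ᶠ a → Precedes a b p → Precedes a b q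
sweep-preservesInversion done                   _   a≺b = a≺b
sweep-preservesInversion (flip xs ys i j i<j s) b<a a≺b =
  sweep-preservesInversion s b<a (Precedes-swap xs a≺b λ { (refl , refl) → Fin.<-asym b<a i<j })

sweep-tileInverted : ∀ {p q : List (Fin n)} {ts} → Sweep p q ts → ∀ {c} → c ∈ ts → Precedes (hi c) (lo c) q
sweep-tileInverted (flip xs ys i j i<j s) (here refl) = sweep-preservesInversion s i<j (Precedes-at xs)
sweep-tileInverted (flip xs ys i j i<j s) (there c∈)  = sweep-tileInverted s c∈

Precedes-sorted : ∀ {xs : List (Fin n)} {a b} → Sorted xs → Precedes a b xs → a <ᶠ b
Precedes-sorted (a< ∷ _)      (now b∈)    = All.lookup a< b∈
Precedes-sorted (_  ∷ sorted) (later a≺b) = Precedes-sorted sorted a≺b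

Precedes-removeMiddle : ∀ {a b : Fin n} as {x bs} → Precedes a b (as ++ x ∷ bs) → a ≡ x ⊎ b ≡ x ⊎ Precedes a b (as ++ bs)
Precedes-removeMiddle []       (now _)     = inj₁ refl
Precedes-removeMiddle []       (later a≺b) = inj₂ (inj₂ a≺b)
Precedes-removeMiddle (_ ∷ as) (now b∈) with ↭.∈-resp-↭ (↭.shift _ as _) b∈
... | here b≡x    = inj₂ (inj₁ b≡x)
... | there b∈as+bs = inj₂ (inj₂ (now b∈as+bs))
Precedes-removeMiddle (_ ∷ as) (later a≺b) with Precedes-removeMiddle as a≺b
... | inj₁ a≡x         = inj₁ a≡x
... | inj₂ (inj₁ b≡x)  = inj₂ (inj₁ b≡x)
... | inj₂ (inj₂ a≺b′) = inj₂ (inj₂ (later a≺b′))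

inversion-involves : ∀ {a b : Fin n} as {x bs} → Sorted (as ++ bs) → b <ᶠ a → Precedes a b (as ++ x ∷ bs) → a ≡ x ⊎ b ≡ x
inversion-involves as sorted b<a a≺b with Precedes-removeMiddle as a≺b
... | inj₁ a≡x         = inj₁ a≡x
... | inj₂ (inj₁ b≡x)  = inj₂ b≡x
... | inj₂ (inj₂ a≺b′) = ⊥-elim (Fin.<-asym b<a (Precedes-sorted sorted a≺b′))

bubbleRight : ∀ (pre : List (Fin n)) x ys zs → All (x <ᶠ_) ys →
  Σ (List (Tile n)) λ ts → Sweep (pre ++ x ∷ ys ++ zs) (pre ++ ys ++ x ∷ zs) ts ×
    (∀ {y ys′} → ys ≡ y ∷ ys′ → tile (vertexOf pre) x y ∈ ts)
bubbleRight pre x []       zs []           = [] , done , λ ()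
bubbleRight pre x (y ∷ ys) zs (x<y ∷ x<ys) with ts , s , _ ← bubbleRight (pre ∷ʳ y) x ys zs x<ys =
  tile (vertexOf pre) x y ∷ ts ,
  flip pre (ys ++ zs) x y x<y (sweep-cast (++-assoc pre [ y ] _) (++-assoc pre [ y ] _) refl s) ,
  λ { refl → here refl }

bubbleLeft : ∀ (pre : List (Fin n)) ys x zs → All (_<ᶠ x) ys →
  Σ (List (Tile n)) λ ts → Sweep (pre ++ ys ++ x ∷ zs) (pre ++ x ∷ ys ++ zs) ts ×
    (∀ {as z} → ys ≡ as ∷ʳ z → tile (vertexOf (pre ++ as)) z x ∈ ts) ×
    (∀ {y ys′} → ys ≡ y ∷ ys′ → tile (vertexOf pre) y x ∈ ts)
bubbleLeft pre []       x zs []           = [] , done , (λ { {[]} () ; {_ ∷ _} () }) , λ ()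
bubbleLeft pre (y ∷ ys) x zs (y<x ∷ ys<x) with ts , s , firstTile , _ ← bubbleLeft (pre ∷ʳ y) ys x zs ys<x =
  ts ∷ʳ tile (vertexOf pre) y x ,
  sweep-++ (sweep-cast (++-assoc pre [ y ] _) (++-assoc pre [ y ] _) refl s) (flip pre (ys ++ zs) y x y<x done) ,
  firstTile′ , λ { refl → ∈-++⁺ʳ ts (here refl) }
  where
  firstTile′ : ∀ {as z} → y ∷ ys ≡ as ∷ʳ z → tile (vertexOf (pre ++ as)) z x ∈ ts ∷ʳ tile (vertexOf pre) y x
  firstTile′ {[]}     refl = ∈-++⁺ʳ ts (here (cong (λ v → tile v y x) (cong vertexOf (++-identityʳ pre))))
  firstTile′ {a ∷ as} eq with refl , ys≡ ← ∷-injective eq =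
    ∈-++⁺ˡ (subst (λ v → tile v _ x ∈ ts) (cong vertexOf (++-assoc pre [ y ] as)) (firstTile ys≡))

sweep-fromSorted : ∀ {p q : List (Fin n)} → Sorted p → q ↭ p → ∃ (Sweep p q)
sweep-fromSorted {p = []}    {[]} _ _ = [] , done
sweep-fromSorted {p = _ ∷ _} {[]} _ []↭p with ↭.∈-resp-↭ (↭-sym []↭p) (here refl)
... | ()
sweep-fromSorted {q = x ∷ q} sorted q↭p with ys , zs , refl ← ∈-∃++ (↭.∈-resp-↭ q↭p (here refl)) =
  let ts₁ , s₁ , _ = bubbleLeft [] ys x zs (All.tabulate λ y∈ → AllPairs-++⇒R ys sorted y∈ (here refl))
      ts₂ , s₂ = sweep-fromSorted {q = q} (AllPairs-removeMiddle ys [ x ] sorted) (↭.drop-mid [] ys q↭p)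
  in ts₁ ++ map (translateTile [ x ]) ts₂ , sweep-++ s₁ (sweep-prefix [ x ] s₂)

Crossing : List (Fin n) → Fin n → Tile n → Set
Crossing L x c = ∃₂ λ as j → ∃ λ bs → L ≡ as ++ j ∷ bs × (c ≡ tile (vertexOf as) x j ⊎ c ≡ tile (vertexOf as) j x)

sweep-crossings : ∀ {L : List (Fin n)} {x} → x ∉ L → ∀ {p q ts} → Sweep p q ts → ∀ as bs → p ≡ as ++ x ∷ bs → L ≡ as ++ bs →
  (∀ {c} → c ∈ ts → lo c ≡ x ⊎ hi c ≡ x) → ∀ {c} → c ∈ ts → Crossing L x c
sweep-crossings {x = x} x∉L (flip xs ys i j i<j s) as bs p≡ L≡ involves c∈
  with involves (here refl) | ∉-++⁻ as (subst (x ∉_) L≡ x∉L)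
... | inj₁ refl | x∉as , x∉bs with refl , refl ← split-injective as bs xs (j ∷ ys) x∉as x∉bs (sym p≡) with c∈
...   | here refl = as , j , ys , L≡ , inj₁ refl
...   | there c∈′ = sweep-crossings x∉L s (as ∷ʳ j) ys (sym (++-assoc as [ j ] (x ∷ ys)))
                      (trans L≡ (sym (++-assoc as [ j ] ys))) (involves ∘ there) c∈′
sweep-crossings {x = x} x∉L (flip xs ys i j i<j s) as bs p≡ L≡ involves c∈ | inj₂ refl | x∉as , x∉bs
  with refl , refl ← split-injective as bs (xs ∷ʳ i) ys x∉as x∉bs (trans (sym p≡) (sym (++-assoc xs [ i ] (x ∷ ys))))
  with c∈
...   | here refl = xs , i , ys , trans L≡ (++-assoc xs [ i ] ys) , inj₂ refl
...   | there c∈′ = sweep-crossings x∉L s xs (i ∷ ys) refl (trans L≡ (++-assoc xs [ i ] ys)) (involves ∘ there) c∈′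

-- Shift permutations

EndSide : Permutation′ n → Fin n → List (Fin n) → Set
EndSide {n} w x L = (leftPath n ≡ x ∷ L × rightPath w ≡ L ∷ʳ x) ⊎ (leftPath n ≡ L ∷ʳ x × rightPath w ≡ x ∷ L)

endSide-boundaryEdge : ∀ {w : Permutation′ n} {x L} → EndSide w x L → x ∉ L →
  ∀ {v} → BoundaryEdge w (v , x) → v ≡ vertexOf [] ⊎ v ≡ vertexOf L
endSide-boundaryEdge {x = x} {L} end x∉L e with end | e
... | inj₁ (left≡ , _) | inj₁ e∈ = inj₁ (edgesOfPath-uniqueLabel [] L left≡ (λ ()) x∉L e∈)
... | inj₁ (_ , right≡) | inj₂ e∈ = inj₂ (edgesOfPath-uniqueLabel L [] right≡ x∉L (λ ()) e∈)
... | inj₂ (left≡ , _) | inj₁ e∈ = inj₂ (edgesOfPath-uniqueLabel L [] left≡ x∉L (λ ()) e∈)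
... | inj₂ (_ , right≡) | inj₂ e∈ = inj₁ (edgesOfPath-uniqueLabel [] L right≡ (λ ()) x∉L e∈)

endSide-crossingEdge : ∀ {w : Permutation′ n} {x L} → EndSide w x L → Unique (x ∷ L) → ∀ {as j bs} → L ≡ as ++ j ∷ bs →
  BoundaryEdge w (vertexOf as , x) ⊎ BoundaryEdge w (vertexOf (j ∷ as) , x) → as ≡ [] ⊎ bs ≡ []
endSide-crossingEdge {w = w} end uxL {as} {j} {bs} refl (inj₁ e) with endSide-boundaryEdge {w = w} end (Unique-∷⇒∉ uxL) e
... | inj₁ as≈[] = inj₁ (vertexOf-≡[] as≈[])
... | inj₂ as≈L  = ⊥-elim (Unique-++⇒∉ as (AllPairs-++⁻ʳ [ _ ] uxL)
                            (vertexOf-⊆ (sym as≈L) (∈-++⁺ʳ as (here refl))) (here refl))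
endSide-crossingEdge end uxL {bs = []}     _    (inj₂ _) = inj₂ refl
endSide-crossingEdge {w = w} end uxL {as} {j} {b ∷ bs} refl (inj₂ e) with endSide-boundaryEdge {w = w} end (Unique-∷⇒∉ uxL) e
... | inj₁ j∷as≈[] = case vertexOf-≡[] {xs = j ∷ as} j∷as≈[] of λ ()
... | inj₂ j∷as≈L with vertexOf-⊆ {ys = j ∷ as} (sym j∷as≈L) (∈-++⁺ʳ as (there (here refl)))
...   | here b≡j   = ⊥-elim (Unique-∷⇒∉ (AllPairs-++⁻ʳ (_ ∷ as) uxL) (here (sym b≡j)))
...   | there b∈as = ⊥-elim (Unique-++⇒∉ as (AllPairs-++⁻ʳ [ _ ] uxL) b∈as (there (here refl)))

perimeterCrossing-atEnd : ∀ {w : Permutation′ n} {x L c} → EndSide w x L → Unique (x ∷ L) →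
  Crossing L x c → PerimeterTile w c →
  ∃₂ λ as j → ∃ λ bs → L ≡ as ++ j ∷ bs × (as ≡ [] ⊎ bs ≡ []) × (c ≡ tile (vertexOf as) x j ⊎ c ≡ tile (vertexOf as) j x)
perimeterCrossing-atEnd {w = w} end uxL (as , j , bs , L≡ , inj₁ refl) perim =
  as , j , bs , L≡ , endSide-crossingEdge {w = w} end uxL L≡ (perimeter-loEdge {w = w} perim) , inj₁ refl
perimeterCrossing-atEnd {w = w} end uxL (as , j , bs , L≡ , inj₂ refl) perim =
  as , j , bs , L≡ , endSide-crossingEdge {w = w} end uxL L≡ (perimeter-hiEdge {w = w} perim) , inj₂ refl

atMostTwoPerimeterTiles-firstToLast : ∀ {w : Permutation′ n} {x l L ts} → leftPath n ≡ x ∷ l ∷ L → rightPath w ≡ (l ∷ L) ∷ʳ x →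
  RhombicTiling w ts → AtMostTwo (PerimeterTileOf w ts)
atMostTwoPerimeterTiles-firstToLast {n} {w} {x} {l} {L} {ts} left≡ right≡ tiling =
  AtMostTwo-mono atEnd (EndPosition-atMostTwo (λ as j → tile (vertexOf as) x j) l L)
  where
  sorted : Sorted (x ∷ l ∷ L)
  sorted = subst Sorted left≡ (allFin-sorted n)
  unique : Unique (x ∷ l ∷ L)
  unique = subst Unique left≡ (leftPath-unique n)
  involves : ∀ {c} → c ∈ ts → hi c ≡ x ⊎ lo c ≡ x
  involves c∈ = inversion-involves (l ∷ L) (subst Sorted (sym (++-identityʳ _)) (AllPairs-++⁻ʳ [ x ] sorted))
                  (sweep-lo<hi tiling c∈) (subst (Precedes _ _) right≡ (sweep-tileInverted tiling c∈))
  atEnd : ∀ {c} → PerimeterTileOf w ts c → EndPosition (λ as j → tile (vertexOf as) x j) (l ∷ L) c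
  atEnd (c∈ , perim)
    with perimeterCrossing-atEnd {w = w} (inj₁ (left≡ , right≡)) unique
           (sweep-crossings (Unique-∷⇒∉ unique) tiling [] (l ∷ L) left≡ refl (swap ∘ involves) c∈) perim
  ... | as , j , bs , L≡ , end , inj₁ refl = as , j , bs , L≡ , end , refl
  ... | as , j , bs , L≡ , end , inj₂ refl =
    ⊥-elim (Fin.<-asym (sweep-lo<hi tiling c∈) (All.lookup (AllPairs.head sorted) (subst (j ∈_) (sym L≡) (∈-++⁺ʳ as (here refl)))))

atMostTwoPerimeterTiles-lastToFirst : ∀ {w : Permutation′ n} {x l L ts} → leftPath n ≡ (l ∷ L) ∷ʳ x → rightPath w ≡ x ∷ l ∷ L →
  RhombicTiling w ts → AtMostTwo (PerimeterTileOf w ts)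
atMostTwoPerimeterTiles-lastToFirst {n} {w} {x} {l} {L} {ts} left≡ right≡ tiling =
  AtMostTwo-mono atEnd (EndPosition-atMostTwo (λ as j → tile (vertexOf as) j x) l L)
  where
  sorted : Sorted ((l ∷ L) ∷ʳ x)
  sorted = subst Sorted left≡ (allFin-sorted n)
  unique : Unique (x ∷ l ∷ L)
  unique = subst Unique right≡ (rightPath-unique w)
  involves : ∀ {c} → c ∈ ts → hi c ≡ x ⊎ lo c ≡ x
  involves c∈ = inversion-involves [] (subst Sorted (++-identityʳ _) (AllPairs-removeMiddle (l ∷ L) [ x ] sorted))
                  (sweep-lo<hi tiling c∈) (subst (Precedes _ _) right≡ (sweep-tileInverted tiling c∈))
  atEnd : ∀ {c} → PerimeterTileOf w ts c → EndPosition (λ as j → tile (vertexOf as) j x) (l ∷ L) c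
  atEnd (c∈ , perim)
    with perimeterCrossing-atEnd {w = w} (inj₂ (left≡ , right≡)) unique
           (sweep-crossings (Unique-∷⇒∉ unique) tiling (l ∷ L) [] left≡ (sym (++-identityʳ _)) (swap ∘ involves) c∈) perim
  ... | as , j , bs , L≡ , end , inj₂ refl = as , j , bs , L≡ , end , refl
  ... | as , j , bs , L≡ , end , inj₁ refl =
    ⊥-elim (Fin.<-asym (sweep-lo<hi tiling c∈) (AllPairs-++⇒R (l ∷ L) sorted (subst (j ∈_) (sym L≡) (∈-++⁺ʳ as (here refl))) (here refl)))

atMostTwo⇒exactlyTwoPerimeterTiles : ∀ {w : Permutation′ n} {ts} → 2 < n → Indecomposable w → RhombicTiling w ts →
  AtMostTwo (PerimeterTileOf w ts) → ExactlyTwo (PerimeterTile w) ts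
atMostTwo⇒exactlyTwoPerimeterTiles {w = w} n>2 indec tiling atMostTwo with sweep-firstTile tiling | sweep-lastTile tiling
... | inj₁ left≡right | _ = ⊥-elim (leftPath≢rightPath {w = w} (ℕ.<-trans (ℕ.n<1+n 1) n>2) indec left≡right)
... | _ | inj₁ left≡right = ⊥-elim (leftPath≢rightPath {w = w} (ℕ.<-trans (ℕ.n<1+n 1) n>2) indec left≡right)
... | inj₂ (a , a∈ , aCorner) | inj₂ (b , b∈ , bCorner) =
  atMostTwo⇒exactlyTwo atMostTwo (leftCorner≢rightCorner {w = w} n>2 indec aCorner bCorner) a∈ b∈
    (leftCorner⇒perimeter w aCorner) (rightCorner⇒perimeter w bCorner)

IsShiftDown IsShiftUp : Permutation′ n → Set
IsShiftDown {n} w = ∀ (k : Fin n) → toℕ (w ⟨$⟩ʳ k) ≡ shiftDown n (toℕ k)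
IsShiftUp   {n} w = ∀ (k : Fin n) → toℕ (w ⟨$⟩ʳ k) ≡ shiftUp n (toℕ k)

shiftUp-inject₁ : ∀ {m} (k : Fin m) → shiftUp (suc m) (toℕ (inject₁ k)) ≡ suc (toℕ k)
shiftUp-inject₁ {m} k rewrite Fin.toℕ-inject₁ k with suc (toℕ k) ℕ.≟ suc m
... | yes k+1≡m+1 = ⊥-elim (ℕ.<-irrefl (ℕ.suc-injective k+1≡m+1) (Fin.toℕ<n k))
... | no  _       = refl

shiftUp-fromℕ : ∀ m → shiftUp (suc m) (toℕ (fromℕ m)) ≡ 0
shiftUp-fromℕ m rewrite Fin.toℕ-fromℕ m with suc m ℕ.≟ suc m
... | yes _   = refl
... | no  m≢m = ⊥-elim (m≢m refl)

rightPath-∷ : ∀ {m} (w : Permutation′ (suc m)) → rightPath w ≡ (w ⟨$⟩ʳ Fin.zero) ∷ map ((w ⟨$⟩ʳ_) ∘ Fin.suc) (allFin m)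
rightPath-∷ {m} w = trans (cong (map (w ⟨$⟩ʳ_)) (allFin-suc m)) (cong ((w ⟨$⟩ʳ Fin.zero) ∷_) (sym (map-∘ (allFin m))))

rightPath-∷ʳ : ∀ {m} (w : Permutation′ (suc m)) → rightPath w ≡ map ((w ⟨$⟩ʳ_) ∘ inject₁) (allFin m) ∷ʳ (w ⟨$⟩ʳ fromℕ m)
rightPath-∷ʳ {m} w =
  trans (cong (map (w ⟨$⟩ʳ_)) (allFin-∷ʳ m)) (trans (map-++ _ (map inject₁ (allFin m)) _) (cong (_∷ʳ (w ⟨$⟩ʳ fromℕ m)) (sym (map-∘ (allFin m)))))

isShiftDown⇔rightPath : ∀ {m} (w : Permutation′ (suc m)) → IsShiftDown w ⇔ rightPath w ≡ fromℕ m ∷ map inject₁ (allFin m)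
isShiftDown⇔rightPath {m} w = mk⇔ to from
  where
  to : IsShiftDown w → rightPath w ≡ fromℕ m ∷ map inject₁ (allFin m)
  to shift = trans (rightPath-∷ w) (cong₂ _∷_
    (Fin.toℕ-injective (trans (shift Fin.zero) (sym (Fin.toℕ-fromℕ m))))
    (map-cong (λ k → Fin.toℕ-injective (trans (shift (Fin.suc k)) (sym (Fin.toℕ-inject₁ k)))) (allFin m)))
  from : rightPath w ≡ fromℕ m ∷ map inject₁ (allFin m) → IsShiftDown w
  from eq Fin.zero    = trans (cong toℕ (proj₁ (∷-injective (trans (sym (rightPath-∷ w)) eq)))) (Fin.toℕ-fromℕ m)
  from eq (Fin.suc k) = trans (cong toℕ (map-≡⇒pointwise (allFin m) (proj₂ (∷-injective (trans (sym (rightPath-∷ w)) eq)))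
                                           (∈-allFin k)))
                              (Fin.toℕ-inject₁ k)

isShiftUp⇔rightPath : ∀ {m} (w : Permutation′ (suc m)) → IsShiftUp w ⇔ rightPath w ≡ map Fin.suc (allFin m) ∷ʳ Fin.zero
isShiftUp⇔rightPath {m} w = mk⇔ to from
  where
  to : IsShiftUp w → rightPath w ≡ map Fin.suc (allFin m) ∷ʳ Fin.zero
  to shift = trans (rightPath-∷ʳ w) (cong₂ _∷ʳ_
    (map-cong (λ k → Fin.toℕ-injective (trans (shift (inject₁ k)) (shiftUp-inject₁ k))) (allFin m))
    (Fin.toℕ-injective (trans (shift (fromℕ m)) (shiftUp-fromℕ m))))
  from : rightPath w ≡ map Fin.suc (allFin m) ∷ʳ Fin.zero → IsShiftUp w
  from eq k with init≡ , last≡ ← ∷ʳ-injective _ _ (trans (sym (rightPath-∷ʳ w)) eq)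
             | ∈-++⁻ (map inject₁ (allFin m)) (subst (k ∈_) (allFin-∷ʳ m) (∈-allFin k))
  ... | inj₁ k∈ with k′ , _ , refl ← ∈-map⁻ inject₁ k∈ =
    trans (cong toℕ (map-≡⇒pointwise (allFin m) init≡ (∈-allFin k′))) (sym (shiftUp-inject₁ k′))
  ... | inj₂ (here refl) = trans (cong toℕ last≡) (sym (shiftUp-fromℕ m))

AllTilingsHaveTwoPerimeterTiles : Permutation′ n → Set
AllTilingsHaveTwoPerimeterTiles {n} w = ∀ (ts : List (Tile n)) → RhombicTiling w ts → ExactlyTwo (PerimeterTile w) ts

shifts⇒exactlyTwo : ∀ {m} (w : Permutation′ (3 + m)) → Indecomposable w → IsShiftDown w ⊎ IsShiftUp w →
  AllTilingsHaveTwoPerimeterTiles w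
shifts⇒exactlyTwo {m} w indec (inj₁ down) ts tiling =
  atMostTwo⇒exactlyTwoPerimeterTiles {w = w} (s<s (s<s (s<s z≤n))) indec tiling
    (atMostTwoPerimeterTiles-lastToFirst {w = w} (allFin-∷ʳ (2 + m)) (Equivalence.to (isShiftDown⇔rightPath w) down) tiling)
shifts⇒exactlyTwo {m} w indec (inj₂ up) ts tiling =
  atMostTwo⇒exactlyTwoPerimeterTiles {w = w} (s<s (s<s (s<s z≤n))) indec tiling
    (atMostTwoPerimeterTiles-firstToLast {w = w} (allFin-suc (2 + m)) (Equivalence.to (isShiftUp⇔rightPath w) up) tiling)

-- Three perimeter tiles

rotation⇒shiftDown : ∀ {M} {w : Permutation′ (suc M)} → Indecomposable w → ∀ Q y R →
  leftPath (suc M) ≡ Fin.zero ∷ Q ++ y ∷ R → rightPath w ≡ y ∷ Fin.zero ∷ Q ++ R → IsShiftDown w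
rotation⇒shiftDown {M} {w} _ Q y [] left≡ right≡
  with zero∷Q≡ , refl ← ∷ʳ-injective (Fin.zero ∷ Q) (map inject₁ (allFin M)) (trans (sym left≡) (allFin-∷ʳ M)) =
  Equivalence.from (isShiftDown⇔rightPath w) (trans right≡ (cong (y ∷_) (trans (++-identityʳ _) zero∷Q≡)))
rotation⇒shiftDown {M} {w} indec Q y (b ∷ R) left≡ right≡ =
  ⊥-elim (noCommonVertex {w = w} indec ((Fin.zero ∷ Q) ∷ʳ y) (y ∷ Fin.zero ∷ Q)
           (trans left≡ (sym (++-assoc (Fin.zero ∷ Q) [ y ] (b ∷ R)))) right≡ (λ ()) (vertexOf-∷ʳ (Fin.zero ∷ Q) y))

module PivotTiling {M} (w : Permutation′ (suc M)) (P Qᵢ R W : List (Fin (suc M))) (z y : Fin (suc M))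
  (left≡ : leftPath (suc M) ≡ Fin.zero ∷ P ++ (Qᵢ ∷ʳ z) ++ y ∷ R) (right≡ : rightPath w ≡ P ++ y ∷ W) where

  private
    Q U : List (Fin (suc M))
    Q = Qᵢ ∷ʳ z
    U = Fin.zero ∷ Q ++ R

    sorted : Sorted (Fin.zero ∷ P ++ Q ++ y ∷ R)
    sorted = subst Sorted left≡ (allFin-sorted (suc M))

    sorted₀Qy : Sorted (Fin.zero ∷ Q ++ y ∷ R)
    sorted₀Qy = AllPairs-removeMiddle [ Fin.zero ] P sorted

    stage₁ : Σ (List (Tile (suc M))) λ ts → Sweep (Fin.zero ∷ P ++ Q ++ y ∷ R) (P ++ Fin.zero ∷ Q ++ y ∷ R) ts ×
               (∀ {p P′} → P ≡ p ∷ P′ → tile (vertexOf []) Fin.zero p ∈ ts)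
    stage₁ = bubbleRight [] Fin.zero P (Q ++ y ∷ R) (proj₁ (All.++⁻ P (AllPairs.head sorted)))
    stage₂ : Σ (List (Tile (suc M))) λ ts → Sweep (P ++ Fin.zero ∷ Q ++ y ∷ R) (P ++ y ∷ U) ts ×
               (∀ {as z′} → Fin.zero ∷ Q ≡ as ∷ʳ z′ → tile (vertexOf (P ++ as)) z′ y ∈ ts) ×
               (∀ {y′ ys′} → Fin.zero ∷ Q ≡ y′ ∷ ys′ → tile (vertexOf P) y′ y ∈ ts)
    stage₂ = bubbleLeft P (Fin.zero ∷ Q) y R (All.tabulate λ q∈ → AllPairs-++⇒R (Fin.zero ∷ Q) sorted₀Qy q∈ (here refl))

    tiles₁₂ : List (Tile (suc M))
    tiles₁₂ = proj₁ stage₁ ++ proj₁ stage₂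

    tiling₁₂ : Sweep (leftPath (suc M)) (P ++ y ∷ U) tiles₁₂
    tiling₁₂ = sweep-cast (sym left≡) refl refl (sweep-++ (proj₁ (proj₂ stage₁)) (proj₁ (proj₂ stage₂)))

    W↭U : W ↭ U
    W↭U = ↭.drop-∷ (↭-++-cancelˡ P (subst (_↭ P ++ y ∷ U) right≡ (↭-trans (rightPath↭leftPath w) (sweep⇒↭ tiling₁₂))))

    stage₃ : ∃ (Sweep U W)
    stage₃ = sweep-fromSorted (AllPairs-removeMiddle (Fin.zero ∷ Q) [ y ] sorted₀Qy) W↭U

    P∷y≡ : ∀ (V : List (Fin (suc M))) → (P ∷ʳ y) ++ V ≡ P ++ y ∷ V
    P∷y≡ V = ++-assoc P [ y ] V

  tiles : List (Tile (suc M))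
  tiles = tiles₁₂ ++ map (translateTile (P ∷ʳ y)) (proj₁ stage₃)

  tiling : RhombicTiling w tiles
  tiling = sweep-++ tiling₁₂ (sweep-cast (P∷y≡ U) (trans (P∷y≡ W) (sym right≡)) refl (sweep-prefix (P ∷ʳ y) (proj₂ stage₃)))

  first∈ : ∀ {p P′} → P ≡ p ∷ P′ → tile (vertexOf []) Fin.zero p ∈ tiles
  first∈ P≡ = ∈-++⁺ˡ (∈-++⁺ˡ (proj₂ (proj₂ stage₁) P≡))

  pivot : Tile (suc M)
  pivot = tile (vertexOf (P ++ Fin.zero ∷ Qᵢ)) z y

  pivot∈ : pivot ∈ tiles
  pivot∈ = ∈-++⁺ˡ (∈-++⁺ʳ (proj₁ stage₁) (proj₁ (proj₂ (proj₂ stage₂)) {as = Fin.zero ∷ Qᵢ} refl))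

  pivot-corner : LeftCorner (leftPath (suc M)) pivot
  pivot-corner = Fin.zero ∷ P ++ Qᵢ , R , trans left≡ (cong (Fin.zero ∷_) regroup) , vertexOf-++-∷ P Fin.zero Qᵢ
    where
    regroup : P ++ Q ++ y ∷ R ≡ (P ++ Qᵢ) ++ z ∷ y ∷ R
    regroup = trans (cong (P ++_) (++-assoc Qᵢ [ z ] (y ∷ R))) (sym (++-assoc P Qᵢ (z ∷ y ∷ R)))

  pivot≢lo0 : ∀ {t} → lo t ≡ Fin.zero → t ≢ pivot
  pivot≢lo0 lo≡0 refl = Unique-∷⇒∉ (subst Unique left≡ (leftPath-unique (suc M)))
                          (subst (_∈ P ++ Q ++ y ∷ R) lo≡0 (∈-++⁺ʳ P (∈-++⁺ˡ (∈-++⁺ʳ Qᵢ (here refl)))))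

  last : Tile (suc M)
  last = tile (vertexOf P) Fin.zero y

  last∈ : last ∈ tiles
  last∈ = ∈-++⁺ˡ (∈-++⁺ʳ (proj₁ stage₁) (proj₂ (proj₂ (proj₂ stage₂)) refl))

  finalStage : U ≡ W ⊎ ∃ λ t → t ∈ tiles × RightCorner (rightPath w) t × top t ≢ vertexOf []
  finalStage with sweep-lastTile (proj₂ stage₃)
  ... | inj₁ U≡W = inj₁ U≡W
  ... | inj₂ (t , t∈ , corner@(xs , _ , _ , top≡)) =
    inj₂ (translateTile (P ∷ʳ y) t , ∈-++⁺ʳ tiles₁₂ (∈-map⁺ _ t∈) ,
          subst (λ p → RightCorner p _) (trans (P∷y≡ W) (sym right≡)) (RightCorner-prefix (P ∷ʳ y) corner) ,
          λ top≡[] → ++-∷≢[] P (trans (sym (P∷y≡ xs)) (vertexOf-≡[]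
            (trans (vertexOf-++ (P ∷ʳ y) xs) (trans (cong (translate (P ∷ʳ y)) (sym top≡)) top≡[])))))

pivot⇒shiftDown : ∀ {M} (w : Permutation′ (suc M)) → 2 < suc M → Indecomposable w → AllTilingsHaveTwoPerimeterTiles w →
  ∀ P Qᵢ z y R W → leftPath (suc M) ≡ Fin.zero ∷ P ++ (Qᵢ ∷ʳ z) ++ y ∷ R → rightPath w ≡ P ++ y ∷ W → IsShiftDown w
pivot⇒shiftDown {M} w n>2 indec two (p ∷ P′) Qᵢ z y R W left≡ right≡ =
  ⊥-elim ([ lastIsCorner , finalTile ]′ finalStage)
  where
  open PivotTiling w (p ∷ P′) Qᵢ R W z y left≡ right≡
  three : ∀ {a b c} → a ≢ b → a ≢ c → b ≢ c →
          PerimeterTileOf w tiles a → PerimeterTileOf w tiles b → PerimeterTileOf w tiles c → ⊥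
  three = atMostTwo-¬three (exactlyTwo⇒atMostTwo (two tiles tiling))
  first-corner : LeftCorner (leftPath (suc M)) (tile (vertexOf []) Fin.zero p)
  first-corner = [] , _ , left≡ , refl
  withFirstAndPivot : ∀ {t} → t ∈ tiles → RightCorner (rightPath w) t → ⊥
  withFirstAndPivot t∈ t-corner =
    three (pivot≢lo0 refl) (leftCorner≢rightCorner {w = w} n>2 indec first-corner t-corner)
          (leftCorner≢rightCorner {w = w} n>2 indec pivot-corner t-corner)
          (first∈ refl , leftCorner⇒perimeter w first-corner) (pivot∈ , leftCorner⇒perimeter w pivot-corner)
          (t∈ , rightCorner⇒perimeter w t-corner)
  lastIsCorner : Fin.zero ∷ (Qᵢ ∷ʳ z) ++ R ≡ W → ⊥
  lastIsCorner U≡W = withFirstAndPivot last∈ (p ∷ P′ , _ , trans right≡ (cong (λ V → p ∷ P′ ++ y ∷ V) (sym U≡W)) , refl)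
  finalTile : (∃ λ t → t ∈ tiles × RightCorner (rightPath w) t × top t ≢ vertexOf []) → ⊥
  finalTile (t , t∈ , t-corner , _) = withFirstAndPivot t∈ t-corner
pivot⇒shiftDown {M} w n>2 indec two [] Qᵢ z y R W left≡ right≡ = [ rotation , ⊥-elim ∘ finalTile ]′ finalStage
  where
  open PivotTiling w [] Qᵢ R W z y left≡ right≡
  rotation : Fin.zero ∷ (Qᵢ ∷ʳ z) ++ R ≡ W → IsShiftDown w
  rotation U≡W = rotation⇒shiftDown {w = w} indec (Qᵢ ∷ʳ z) y R left≡ (trans right≡ (cong (y ∷_) (sym U≡W)))
  last-perimeter : PerimeterTile w last
  last-perimeter = inj₁ (inj₁ (∈-edgesOfPath⁺ [] Fin.zero _ left≡) , inj₂ (∈-edgesOfPath⁺ [] y W right≡))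
  finalTile : (∃ λ t → t ∈ tiles × RightCorner (rightPath w) t × top t ≢ vertexOf []) → ⊥
  finalTile (t , t∈ , t-corner , top≢[]) =
    atMostTwo-¬three (exactlyTwo⇒atMostTwo (two tiles tiling))
      (pivot≢lo0 refl) (λ last≡t → top≢[] (cong top (sym last≡t))) (leftCorner≢rightCorner {w = w} n>2 indec pivot-corner t-corner)
      (last∈ , last-perimeter) (pivot∈ , leftCorner⇒perimeter w pivot-corner) (t∈ , rightCorner⇒perimeter w t-corner)

divergence⇒pivot : ∀ {M} {w : Permutation′ (suc M)} → Indecomposable w → ∀ P y W r R →
  rightPath w ≡ P ++ y ∷ W → leftPath (suc M) ≡ Fin.zero ∷ P ++ r ∷ R → y ≢ r →
  ∃₂ λ Qᵢ z → ∃ λ R₂ → leftPath (suc M) ≡ Fin.zero ∷ P ++ (Qᵢ ∷ʳ z) ++ y ∷ R₂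
divergence⇒pivot {M} {w} indec P y W r R right≡ left≡ y≢r with subst (y ∈_) left≡ (∈-allFin y)
... | here refl = ⊥-elim (noCommonVertex {w = w} indec (Fin.zero ∷ P) (P ∷ʳ Fin.zero) left≡
                           (trans right≡ (sym (++-assoc P [ Fin.zero ] W))) (++-∷≢[] P) (sym (vertexOf-∷ʳ P Fin.zero)))
... | there y∈ with ∈-++⁻ P y∈
...   | inj₁ y∈P        = ⊥-elim (Unique-++⇒∉ P (subst Unique right≡ (rightPath-unique w)) y∈P (here refl))
...   | inj₂ (here y≡r) = ⊥-elim (y≢r y≡r)
...   | inj₂ (there y∈R) with R₁ , R₂ , refl ← ∈-∃++ y∈R with Qᵢ , z , r∷R₁≡ ← ∷⇒∷ʳ r R₁ =
  Qᵢ , z , R₂ , trans left≡ (cong (λ Q → Fin.zero ∷ P ++ Q ++ y ∷ R₂) r∷R₁≡)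

appendedLabel≡0 : ∀ {M} (w : Permutation′ (suc M)) {y} → rightPath w ≡ map Fin.suc (allFin M) ∷ʳ y → y ≡ Fin.zero
appendedLabel≡0 {M} w right≡ with ∈-++⁻ (map Fin.suc (allFin M)) (subst (Fin.zero ∈_) right≡ (rightPath-complete w Fin.zero))
... | inj₁ 0∈ with ∈-map⁻ Fin.suc 0∈
...   | _ , _ , ()
appendedLabel≡0 {M} w right≡ | inj₂ (here 0≡y) = sym 0≡y

exactlyTwo⇒shifts : ∀ {M} (w : Permutation′ (suc M)) → 2 < suc M → Indecomposable w →
  AllTilingsHaveTwoPerimeterTiles w → IsShiftDown w ⊎ IsShiftUp w
exactlyTwo⇒shifts {M} w n>2 indec two with firstDifference Fin._≟_ (rightPath w) (map Fin.suc (allFin M))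
       (trans (length-rightPath w) (cong suc (sym (trans (length-map Fin.suc (allFin M)) (length-allFin M)))))
... | inj₁ (y , right≡) = inj₂ (Equivalence.from (isShiftUp⇔rightPath w)
                                   (subst (λ y → rightPath w ≡ _ ∷ʳ y) (appendedLabel≡0 w right≡) right≡))
... | inj₂ (diverge P y W r R right≡ tail≡ y≢r)
  with Qᵢ , z , R₂ , left≡ ← divergence⇒pivot {w = w} indec P y W r R right≡ (trans (allFin-suc M) (cong (Fin.zero ∷_) tail≡)) y≢r =
  inj₁ (pivot⇒shiftDown w n>2 indec two P Qᵢ z y R₂ W left≡ right≡)

theorem4p5 : (n : ℕ) → 2 < n → (w : Permutation′ n) →
    (∀ r → 1 ≤ r → r < n → ¬ PrefixStable w r) →
    ((∀ (ts : List (Tile n)) → RhombicTiling w ts → ExactlyTwo (PerimeterTile w) ts)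
      ⇔ ((∀ (k : Fin n) → toℕ (w ⟨$⟩ʳ k) ≡ shiftDown n (toℕ k))
         ⊎ (∀ (k : Fin n) → toℕ (w ⟨$⟩ʳ k) ≡ shiftUp n (toℕ k))))
theorem4p5 (suc (suc (suc m))) n>2 w indec = mk⇔ (exactlyTwo⇒shifts w n>2 indec) (shifts⇒exactlyTwo w indec)
theorem4p5 (suc zero)       (s<s ())
theorem4p5 (suc (suc zero)) (s<s (s<s ()))
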